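{- Let $G$ and $H$ be finite digraphs, and let $M$ and $N$ be finitely generated abelian groups with $n(M)=n(N)$. Then the number of $M$-flow-continuous mappings $E(G)\to E(H)$ equals the number of $N$-flow-continuous mappings $E(G)\to E(H)$. In other words, the number of $M$-flow-continuous mappings from $G$ to $H$ depends only on $n(M)$.
   Context: Digraphs are finite multidigraphs; loops and parallel edges are allowed. For an abelian group $M$, a map $\varphi:E(G)\to M$ is an $M$-flow if at every vertex $v$ the sum of $\varphi$ over edges leaving $v$ equals the sum of $\varphi$ over edges entering $v$. A mapping $f:E(G)\to E(H)$ is $M$-flow-continuous if for every $M$-flow $\varphi$ on $H$ the composition $\varphi\circ f$ is an $M$-flow on $G$. Every finitely generated abelian group is isomorphic to $\mathbb{Z}^\alpha\times\prod_{i=1}^k\mathbb{Z}_{n_i}^{\beta_i}$. Set $n(M)=\infty$ if $\alpha>0$, and otherwise $n(M)=\operatorname{lcm}(n_1,\dots,n_k)$; equivalently, $n(M)$ is the largest order of an element of $M$. -}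

module Defs where

open import Data.Nat using (ℕ; zero; suc; _≤_)
open import Data.Nat.LCM using (lcm)
open import Data.Integer using (ℤ; +_) renaming (_+_ to _+ℤ_; _-_ to _-ℤ_)
open import Data.Integer.Divisibility using () renaming (_∣_ to _∣ℤ_)
open import Data.Fin using (Fin; zero; suc; _≟_)
open import Data.Product using (Σ; _×_; _,_; proj₁; proj₂)
open import Relation.Nullary using (does)
open import Data.Bool using (if_then_else_)
open import Relation.Binary.PropositionalEquality using (_≡_; _≗_)

record Digraph : Set where
  field
    nV   : ℕ
    nE   : ℕ
    tail : Fin nE → Fin nV
    head : Fin nE → Fin nV
open Digraph public

-- Finitely generated abelian groups, given in the normal form
--   ℤ^α × ∏_{i<k} ℤ_{n i}^{β i}     (n i ≥ 1, β i ≥ 1).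

record FGAb : Set where
  field
    α     : ℕ
    k     : ℕ
    n     : Fin k → ℕ
    β     : Fin k → ℕ
    n-pos : ∀ i → 1 ≤ n i
    β-pos : ∀ i → 1 ≤ β i
open FGAb public

-- Elements: a free part in ℤ^α and, for each i, a β i-tuple of
-- elements of ℤ_{n i}, represented by integer lifts.
Elt : FGAb → Set
Elt M = (Fin (α M) → ℤ) × ((i : Fin (k M)) → Fin (β M i) → ℤ)

EqM : (M : FGAb) → Elt M → Elt M → Set
EqM M x y =
  ((j : Fin (α M)) → proj₁ x j ≡ proj₁ y j) ×
  ((i : Fin (k M)) (j : Fin (β M i)) → (+ n M i) ∣ℤ (proj₂ x i j -ℤ proj₂ y i j))

0M : (M : FGAb) → Elt M
0M M = (λ _ → + 0) , (λ _ _ → + 0)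

addM : (M : FGAb) → Elt M → Elt M → Elt M
addM M x y = (λ j → proj₁ x j +ℤ proj₁ y j) , (λ i j → proj₂ x i j +ℤ proj₂ y i j)

sumM : (M : FGAb) {m : ℕ} → (Fin m → Elt M) → Elt M
sumM M {zero}  f = 0M M
sumM M {suc m} f = addM M (f zero) (sumM M (λ i → f (suc i)))

outSum : (M : FGAb) (G : Digraph) → (Fin (nE G) → Elt M) → Fin (nV G) → Elt M
outSum M G φ v = sumM M (λ e → if does (tail G e ≟ v) then φ e else 0M M)

inSum : (M : FGAb) (G : Digraph) → (Fin (nE G) → Elt M) → Fin (nV G) → Elt M
inSum M G φ v = sumM M (λ e → if does (head G e ≟ v) then φ e else 0M M)

IsFlow : (M : FGAb) (G : Digraph) → (Fin (nE G) → Elt M) → Set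
IsFlow M G φ = (v : Fin (nV G)) → EqM M (outSum M G φ v) (inSum M G φ v)

FlowContinuous : (M : FGAb) (G H : Digraph) → (Fin (nE G) → Fin (nE H)) → Set
FlowContinuous M G H f =
  (φ : Fin (nE H) → Elt M) → IsFlow M H φ → IsFlow M G (λ e → φ (f e))

data ℕ∞ : Set where
  fin : ℕ → ℕ∞
  ∞   : ℕ∞

lcmFin : {m : ℕ} → (Fin m → ℕ) → ℕ
lcmFin {zero}  f = 1
lcmFin {suc m} f = lcm (f zero) (lcmFin (λ i → f (suc i)))

nOf : FGAb → ℕ∞
nOf M with α M
... | zero  = fin (lcmFin (n M))
... | suc _ = ∞

-- "The predicate P on mappings Fin a → Fin b holds for exactly c mappings":
-- an injective enumeration of c mappings satisfying P, containing every
-- mapping satisfying P (mappings compared pointwise).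

HasCount : {a b : ℕ} → ((Fin a → Fin b) → Set) → ℕ → Set
HasCount {a} {b} P c =
  Σ (Fin c → (Fin a → Fin b)) λ enum →
    ((i j : Fin c) → enum i ≗ enum j → i ≡ j) ×
    ((i : Fin c) → P (enum i)) ×
    ((f : Fin a → Fin b) → P f → Σ (Fin c) λ i → f ≗ enum i)

-- A map f is ℤ_q-flow-continuous iff, for every vertex v of G, the pushforward along f of the
-- cut vector of v annihilates every ℤ_q-flow of H (q = 0 standing for ℤ).  Gaussian elimination
-- on the incidence matrix of H (a loop is a zero column; any other edge has a unit pivot at its
-- tail, and eliminating it contracts the edge) turns this into "q divides each of finitely many
-- integers", which do not depend on q.  Hence the condition is decidable, and holding for all
-- moduli q₁, …, q_r is the same as holding for lcm(q₁, …, q_r).  Since a flow in M is a tuple of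
-- coordinate flows in ℤ and the ℤ_{n_i}, M-flow-continuity is ℤ_{n(M)}-flow-continuity.

module Submission where

open import Defs
open import Data.Nat as ℕ using (ℕ; zero; suc)
import Data.Nat.Divisibility as ℕ
open import Data.Nat.LCM using (m∣lcm[m,n]; n∣lcm[m,n]; lcm-least)
open import Data.Integer using (ℤ; +_; 0ℤ; 1ℤ; _+_; _*_; -_; _-_)
open import Data.Integer.Properties
  using (+-*-semiring; *-zeroʳ; *-identityˡ; *-identityʳ; +-identityˡ; +-identityʳ; +-inverseʳ; *-assoc;
         i≡j⇒i-j≡0; i-j≡0⇒i≡j)
open import Data.Integer.Divisibility.Signed
  using (_∣_; _∣?_; divides; ∣-trans; ∣m∣n⇒∣m+n; ∣n⇒∣m*n; ∣m⇒∣m*n; ∣m+n∣n⇒∣m; ∣ᵤ⇒∣; ∣⇒∣ᵤ; 0∣⇒≡0)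
open import Data.Integer.Tactic.RingSolver using (solve-∀)
open import Algebra.Properties.Semiring.Sum +-*-semiring
  using (sum; sum-cong-≗; sum-replicate-zero; ∑-comm; *-distribˡ-sum; *-distribʳ-sum)
open import Data.Fin using (Fin; zero; suc; _≟_; fromℕ<; combine; finToFun; funToFin)
import Data.Fin.Properties as Fin
open import Data.Fin.Properties using (funToFin-finToFin; finToFun-funToFin)
open import Data.Vec.Functional using (Vector) renaming (_∷_ to _∷ᵥ_)
open import Data.List using (List; []; _∷_)
open import Data.List.Relation.Unary.All as All using (All; []; _∷_)
open import Data.Bool using (if_then_else_)
open import Data.Empty using (⊥-elim)
open import Data.Sum using (_⊎_; inj₁; inj₂)
open import Data.Product using (Σ; _×_; _,_; proj₁; proj₂; uncurry)
open import Data.Product.Function.NonDependent.Propositional using (_×-⇔_)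
open import Function using (_∘_; _⇔_; mk⇔; Equivalence)
open import Function.Properties.Equivalence using () renaming (refl to ⇔-refl; sym to ⇔-sym; trans to ⇔-trans)
open import Relation.Nullary using (Dec; yes; no; does)
import Relation.Nullary.Decidable as Dec
open import Relation.Nullary.Decidable using (dec-true)
open import Relation.Unary using (Decidable)
open import Relation.Binary.PropositionalEquality
  using (_≡_; _≗_; refl; sym; trans; cong; cong₂; subst; module ≡-Reasoning)

open Equivalence using (to; from)

infix 7 _·_

_·_ : ∀ {n} → Vector ℤ n → Vector ℤ n → ℤ
u · w = sum (λ i → u i * w i)

sum-distrib-− : ∀ {n} (f g : Vector ℤ n) → sum (λ i → f i - g i) ≡ sum f - sum g
sum-distrib-− {zero}  f g = refl
sum-distrib-− {suc n} f g =
  trans (cong (_+_ (f zero - g zero)) (sum-distrib-− (f ∘ suc) (g ∘ suc)))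
        (regroup (f zero) (g zero) (sum (f ∘ suc)) (sum (g ∘ suc)))
  where
  regroup : ∀ a b c d → a - b + (c - d) ≡ a + c - (b + d)
  regroup = solve-∀

·-zeroʳ : ∀ {n} (u : Vector ℤ n) → u · (λ _ → 0ℤ) ≡ 0ℤ
·-zeroʳ {n} u = trans (sum-cong-≗ (*-zeroʳ ∘ u)) (sum-replicate-zero n)

⟦_⟧ : ∀ {A : Set} → Dec A → ℤ
⟦ d ⟧ = if does d then 1ℤ else 0ℤ

sum-select : ∀ {n} (x : Fin n) (ψ : Vector ℤ n) → sum (λ y → ⟦ x ≟ y ⟧ * ψ y) ≡ ψ x
sum-select {suc n} zero ψ = begin
  1ℤ * ψ zero + sum {n} (λ _ → 0ℤ)  ≡⟨ cong₂ _+_ (*-identityˡ (ψ zero)) (sum-replicate-zero n) ⟩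
  ψ zero + 0ℤ                        ≡⟨ +-identityʳ (ψ zero) ⟩
  ψ zero                             ∎
  where open ≡-Reasoning
sum-select {suc n} (suc x) ψ = trans (+-identityˡ _) (sum-select x (ψ ∘ suc))

pushforward : ∀ {m n} → (Fin m → Fin n) → Vector ℤ m → Vector ℤ n
pushforward f u y = sum (λ x → u x * ⟦ f x ≟ y ⟧)

·-pushforward : ∀ {m n} (f : Fin m → Fin n) (u : Vector ℤ m) (ψ : Vector ℤ n) →
                u · (ψ ∘ f) ≡ pushforward f u · ψ
·-pushforward {m} {n} f u ψ = sym (begin
  sum (λ y → sum (λ x → u x * ⟦ f x ≟ y ⟧) * ψ y)
    ≡⟨ sum-cong-≗ (λ y → *-distribʳ-sum (ψ y) (λ x → u x * ⟦ f x ≟ y ⟧)) ⟩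
  sum (λ y → sum (λ x → u x * ⟦ f x ≟ y ⟧ * ψ y))
    ≡⟨ ∑-comm {n} {m} (λ y x → u x * ⟦ f x ≟ y ⟧ * ψ y) ⟩
  sum (λ x → sum (λ y → u x * ⟦ f x ≟ y ⟧ * ψ y))
    ≡⟨ sum-cong-≗ (λ x → sum-cong-≗ (λ y → *-assoc (u x) _ (ψ y))) ⟩
  sum (λ x → sum (λ y → u x * (⟦ f x ≟ y ⟧ * ψ y)))
    ≡⟨ sum-cong-≗ (λ x → sym (*-distribˡ-sum (u x) (λ y → ⟦ f x ≟ y ⟧ * ψ y))) ⟩
  sum (λ x → u x * sum (λ y → ⟦ f x ≟ y ⟧ * ψ y))
    ≡⟨ sum-cong-≗ (λ x → cong (u x *_) (sum-select (f x) ψ)) ⟩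
  sum (λ x → u x * ψ (f x))
    ∎)
  where open ≡-Reasoning

∣0 : ∀ {q} → q ∣ 0ℤ
∣0 = divides 0ℤ refl

Matrix : ℕ → ℕ → Set
Matrix m n = Fin m → Vector ℤ n

InKernel : ∀ {m n} → ℤ → Matrix m n → Vector ℤ n → Set
InKernel q B ψ = ∀ v → q ∣ B v · ψ

⊥Kernel : ∀ {m n} → ℤ → Matrix m n → Vector ℤ n → Set
⊥Kernel q B c = ∀ ψ → InKernel q B ψ → q ∣ c · ψ

InKernel-cong : ∀ {m n q} (B : Matrix m n) {ψ ψ′ : Vector ℤ n} →
                ψ ≗ ψ′ → InKernel q B ψ → InKernel q B ψ′
InKernel-cong {q = q} B ψ≗ψ′ ψ∈ker v =
  subst (q ∣_) (sum-cong-≗ (λ e → cong (B v e *_) (ψ≗ψ′ e))) (ψ∈ker v)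

InKernel-zero : ∀ {m n q} (B : Matrix m n) → InKernel q B (λ _ → 0ℤ)
InKernel-zero {q = q} B v = subst (q ∣_) (sym (·-zeroʳ (B v))) ∣0

⊥Kernel-cong : ∀ {m n q} {B B′ : Matrix m n} {c : Vector ℤ n} →
               (∀ v → B v ≗ B′ v) → ⊥Kernel q B c → ⊥Kernel q B′ c
⊥Kernel-cong {q = q} B≗B′ c⊥B ψ ψ∈kerB′ = c⊥B ψ (λ v →
  subst (q ∣_) (sum-cong-≗ (λ e → cong (_* ψ e) (sym (B≗B′ v e)))) (ψ∈kerB′ v))

-- A Gaussian elimination step against a pivot row r with r zero = 1; the cleared first entry is dropped.
eliminate : ∀ {n} → Vector ℤ (suc n) → Vector ℤ (suc n) → Vector ℤ n
eliminate r w e = w (suc e) - w zero * r (suc e)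

eliminate-· : ∀ {n} (r w : Vector ℤ (suc n)) (ψ : Vector ℤ n) →
              eliminate r w · ψ ≡ (w ∘ suc) · ψ - w zero * ((r ∘ suc) · ψ)
eliminate-· {n} r w ψ = begin
  sum (λ e → (w (suc e) - w zero * r (suc e)) * ψ e)
    ≡⟨ sum-cong-≗ (λ e → distrib (w (suc e)) (w zero) (r (suc e)) (ψ e)) ⟩
  sum (λ e → w (suc e) * ψ e - w zero * (r (suc e) * ψ e))
    ≡⟨ sum-distrib-− (λ e → w (suc e) * ψ e) (λ e → w zero * (r (suc e) * ψ e)) ⟩
  (w ∘ suc) · ψ - sum (λ e → w zero * (r (suc e) * ψ e))
    ≡⟨ cong (_-_ ((w ∘ suc) · ψ)) (sym (*-distribˡ-sum {n} (w zero) (λ e → r (suc e) * ψ e))) ⟩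
  (w ∘ suc) · ψ - w zero * ((r ∘ suc) · ψ)
    ∎
  where
  open ≡-Reasoning
  distrib : ∀ a b c x → (a - b * c) * x ≡ a * x - b * (c * x)
  distrib = solve-∀

·-eliminate : ∀ {n} (r w : Vector ℤ (suc n)) (ψ : Vector ℤ (suc n)) → r zero ≡ 1ℤ →
              w · ψ ≡ eliminate r w · (ψ ∘ suc) + w zero * (r · ψ)
·-eliminate r w ψ r₀≡1 rewrite eliminate-· r w (ψ ∘ suc) | r₀≡1 =
  regroup (w zero) (ψ zero) ((w ∘ suc) · (ψ ∘ suc)) ((r ∘ suc) · (ψ ∘ suc))
  where
  regroup : ∀ a x s t → a * x + s ≡ s - a * t + a * (1ℤ * x + t)
  regroup = solve-∀

liftAlong : ∀ {n} → Vector ℤ (suc n) → Vector ℤ n → Vector ℤ (suc n)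
liftAlong r ψ = (- ((r ∘ suc) · ψ)) ∷ᵥ ψ

·-liftAlong : ∀ {n} (r : Vector ℤ (suc n)) (ψ : Vector ℤ n) → r zero ≡ 1ℤ → r · liftAlong r ψ ≡ 0ℤ
·-liftAlong r ψ r₀≡1 rewrite r₀≡1 = cancel ((r ∘ suc) · ψ)
  where
  cancel : ∀ t → 1ℤ * (- t) + t ≡ 0ℤ
  cancel = solve-∀

·-eliminate-liftAlong : ∀ {n} (r w : Vector ℤ (suc n)) (ψ : Vector ℤ n) → r zero ≡ 1ℤ →
                        w · liftAlong r ψ ≡ eliminate r w · ψ
·-eliminate-liftAlong r w ψ r₀≡1 = begin
  w · liftAlong r ψ                                 ≡⟨ ·-eliminate r w (liftAlong r ψ) r₀≡1 ⟩
  eliminate r w · ψ + w zero * (r · liftAlong r ψ)  ≡⟨ cong (λ x → eliminate r w · ψ + w zero * x) (·-liftAlong r ψ r₀≡1) ⟩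
  eliminate r w · ψ + w zero * 0ℤ                   ≡⟨ cong (_+_ (eliminate r w · ψ)) (*-zeroʳ (w zero)) ⟩
  eliminate r w · ψ + 0ℤ                            ≡⟨ +-identityʳ _ ⟩
  eliminate r w · ψ                                 ∎
  where open ≡-Reasoning

⊥Kernel-eliminate : ∀ {m n q} (B : Matrix m (suc n)) (u : Fin m) (c : Vector ℤ (suc n)) →
                    B u zero ≡ 1ℤ →
                    ⊥Kernel q B c ⇔ ⊥Kernel q (eliminate (B u) ∘ B) (eliminate (B u) c)
⊥Kernel-eliminate {q = q} B u c pivot = mk⇔ forward backward
  where
  forward : ⊥Kernel q B c → ⊥Kernel q (eliminate (B u) ∘ B) (eliminate (B u) c)
  forward c⊥B ψ ψ∈ker = subst (q ∣_) (·-eliminate-liftAlong (B u) c ψ pivot)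
    (c⊥B (liftAlong (B u) ψ) (λ v → subst (q ∣_) (sym (·-eliminate-liftAlong (B u) (B v) ψ pivot)) (ψ∈ker v)))

  backward : ⊥Kernel q (eliminate (B u) ∘ B) (eliminate (B u) c) → ⊥Kernel q B c
  backward c⊥B′ ψ ψ∈ker = subst (q ∣_) (sym (·-eliminate (B u) c ψ pivot))
    (∣m∣n⇒∣m+n (c⊥B′ (ψ ∘ suc) tailψ∈ker) (∣n⇒∣m*n (c zero) (ψ∈ker u)))
    where
    tailψ∈ker : InKernel q (eliminate (B u) ∘ B) (ψ ∘ suc)
    tailψ∈ker v = ∣m+n∣n⇒∣m (subst (q ∣_) (·-eliminate (B u) (B v) ψ pivot) (ψ∈ker v))
                            (∣n⇒∣m*n (B v zero) (ψ∈ker u))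

⊥Kernel-zeroColumn : ∀ {m n q} (B : Matrix m (suc n)) (c : Vector ℤ (suc n)) →
                     (∀ v → B v zero ≡ 0ℤ) →
                     ⊥Kernel q B c ⇔ (q ∣ c zero × ⊥Kernel q (λ v → B v ∘ suc) (c ∘ suc))
⊥Kernel-zeroColumn {n = n} {q} B c column≡0 = mk⇔ forward backward
  where
  ·-dropZero : ∀ (w ψ : Vector ℤ (suc n)) → w zero ≡ 0ℤ → w · ψ ≡ (w ∘ suc) · (ψ ∘ suc)
  ·-dropZero w ψ w₀≡0 rewrite w₀≡0 = +-identityˡ _

  InKernel-dropZero : ∀ ψ → InKernel q B ψ ⇔ InKernel q (λ v → B v ∘ suc) (ψ ∘ suc)
  InKernel-dropZero ψ = mk⇔ (λ ψ∈ker v → subst (q ∣_) (·-dropZero (B v) ψ (column≡0 v)) (ψ∈ker v))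
                            (λ ψ∈ker v → subst (q ∣_) (sym (·-dropZero (B v) ψ (column≡0 v))) (ψ∈ker v))

  e₀ : Vector ℤ (suc n)
  e₀ = 1ℤ ∷ᵥ λ _ → 0ℤ

  c·e₀≡c₀ : c · e₀ ≡ c zero
  c·e₀≡c₀ = trans (cong₂ _+_ (*-identityʳ (c zero)) (·-zeroʳ (c ∘ suc))) (+-identityʳ (c zero))

  c·0∷≡ : ∀ ψ → c · (0ℤ ∷ᵥ ψ) ≡ (c ∘ suc) · ψ
  c·0∷≡ ψ = trans (cong (_+ (c ∘ suc) · ψ) (*-zeroʳ (c zero))) (+-identityˡ _)

  forward : ⊥Kernel q B c → q ∣ c zero × ⊥Kernel q (λ v → B v ∘ suc) (c ∘ suc)
  forward c⊥B =
      subst (q ∣_) c·e₀≡c₀ (c⊥B e₀ (from (InKernel-dropZero e₀) (InKernel-zero (λ v → B v ∘ suc))))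
    , λ ψ ψ∈ker → subst (q ∣_) (c·0∷≡ ψ) (c⊥B (0ℤ ∷ᵥ ψ) (from (InKernel-dropZero (0ℤ ∷ᵥ ψ)) ψ∈ker))

  backward : q ∣ c zero × ⊥Kernel q (λ v → B v ∘ suc) (c ∘ suc) → ⊥Kernel q B c
  backward (q∣c₀ , c′⊥B′) ψ ψ∈ker =
    ∣m∣n⇒∣m+n (∣m⇒∣m*n (ψ zero) q∣c₀) (c′⊥B′ (ψ ∘ suc) (to (InKernel-dropZero ψ) ψ∈ker))

incidence : ∀ {V E} → (Fin E → Fin V) → (Fin E → Fin V) → Matrix V E
incidence t h v e = ⟦ t e ≟ v ⟧ - ⟦ h e ≟ v ⟧

merge : ∀ {V} → Fin V → Fin V → Fin V → Fin V
merge a b x = if does (x ≟ a) then b else x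

⟦merge≟⟧ : ∀ {V} (a b x v : Fin V) →
           ⟦ merge a b x ≟ v ⟧ ≡ ⟦ x ≟ v ⟧ - ⟦ x ≟ a ⟧ * (⟦ a ≟ v ⟧ - ⟦ b ≟ v ⟧)
⟦merge≟⟧ a b x v with x ≟ a
... | yes refl = collapse ⟦ x ≟ v ⟧ ⟦ b ≟ v ⟧
  where
  collapse : ∀ i j → j ≡ i - 1ℤ * (i - j)
  collapse = solve-∀
... | no _ = keep ⟦ x ≟ v ⟧ (⟦ a ≟ v ⟧ - ⟦ b ≟ v ⟧)
  where
  keep : ∀ i j → i ≡ i - 0ℤ * j
  keep = solve-∀

incidence-merge : ∀ {V E} (t h : Fin E → Fin V) (a b v : Fin V) (e : Fin E) →
                  incidence (merge a b ∘ t) (merge a b ∘ h) v e ≡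
                  incidence t h v e - (⟦ a ≟ v ⟧ - ⟦ b ≟ v ⟧) * incidence t h a e
incidence-merge t h a b v e rewrite ⟦merge≟⟧ a b (t e) v | ⟦merge≟⟧ a b (h e) v =
  regroup ⟦ t e ≟ v ⟧ ⟦ h e ≟ v ⟧ ⟦ t e ≟ a ⟧ ⟦ h e ≟ a ⟧ (⟦ a ≟ v ⟧ - ⟦ b ≟ v ⟧)
  where
  regroup : ∀ i j k l d → (i - k * d) - (j - l * d) ≡ (i - j) - d * (k - l)
  regroup = solve-∀

cutCoordinates : ∀ {V E} (t h : Fin E → Fin V) → Vector ℤ E → List ℤ
cutCoordinates {E = zero}  t h c = []
cutCoordinates {E = suc E} t h c with t zero ≟ h zero
... | yes _ = c zero ∷ cutCoordinates (t ∘ suc) (h ∘ suc) (c ∘ suc)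
... | no _  = cutCoordinates (merge (t zero) (h zero) ∘ t ∘ suc) (merge (t zero) (h zero) ∘ h ∘ suc)
                             (eliminate (incidence t h (t zero)) c)

⊥Kernel-incidence : ∀ {V E q} (t h : Fin E → Fin V) (c : Vector ℤ E) →
                    ⊥Kernel q (incidence t h) c ⇔ All (q ∣_) (cutCoordinates t h c)
⊥Kernel-incidence {E = zero} t h c = mk⇔ (λ _ → []) (λ _ _ _ → ∣0)
⊥Kernel-incidence {E = suc E} t h c with t zero ≟ h zero
... | yes loop = ⇔-trans (⊥Kernel-zeroColumn (incidence t h) c column≡0)
                   (⇔-trans (⇔-refl ×-⇔ ⊥Kernel-incidence (t ∘ suc) (h ∘ suc) (c ∘ suc))
                            (mk⇔ (uncurry _∷_) All.uncons))
  where
  column≡0 : ∀ v → incidence t h v zero ≡ 0ℤ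
  column≡0 v rewrite loop = +-inverseʳ ⟦ h zero ≟ v ⟧
... | no nonloop = ⇔-trans (⊥Kernel-eliminate (incidence t h) (t zero) c pivot≡1)
                     (⇔-trans (mk⇔ (⊥Kernel-cong {c = c′} contracted)
                                   (⊥Kernel-cong {c = c′} (λ v e → sym (contracted v e))))
                              (⊥Kernel-incidence t′ h′ c′))
  where
  t′ h′ : Fin E → Fin _
  t′ = merge (t zero) (h zero) ∘ t ∘ suc
  h′ = merge (t zero) (h zero) ∘ h ∘ suc
  c′ : Vector ℤ E
  c′ = eliminate (incidence t h (t zero)) c
  pivot≡1 : incidence t h (t zero) zero ≡ 1ℤ
  pivot≡1 with t zero ≟ t zero | h zero ≟ t zero
  ... | yes _ | no _ = refl
  ... | no t₀≢t₀ | _ = ⊥-elim (t₀≢t₀ refl)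
  ... | yes _ | yes h₀≡t₀ = ⊥-elim (nonloop (sym h₀≡t₀))
  contracted : ∀ v → eliminate (incidence t h (t zero)) (incidence t h v) ≗ incidence t′ h′ v
  contracted v e = sym (incidence-merge (t ∘ suc) (h ∘ suc) (t zero) (h zero) v e)

incidenceOf : (G : Digraph) → Matrix (nV G) (nE G)
incidenceOf G = incidence (tail G) (head G)

-- InKernel q (incidenceOf G) ψ says that ψ is a ℤ_q-flow on G (a ℤ-flow when q = 0).
FlowContinuousMod : ℤ → (G H : Digraph) → (Fin (nE G) → Fin (nE H)) → Set
FlowContinuousMod q G H f = ∀ ψ → InKernel q (incidenceOf H) ψ → InKernel q (incidenceOf G) (ψ ∘ f)

obstructions : (G H : Digraph) → (Fin (nE G) → Fin (nE H)) → Fin (nV G) → List ℤ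
obstructions G H f v = cutCoordinates (tail H) (head H) (pushforward f (incidenceOf G v))

FlowContinuousMod⇔obstructions : ∀ {q} G H f →
                                 FlowContinuousMod q G H f ⇔ (∀ v → All (q ∣_) (obstructions G H f v))
FlowContinuousMod⇔obstructions {q} G H f = ⇔-trans (mk⇔ to⊥ from⊥)
  (mk⇔ (λ c⊥ v → to (⊥Kernel-incidence (tail H) (head H) _) (c⊥ v))
       (λ obs v → from (⊥Kernel-incidence (tail H) (head H) _) (obs v)))
  where
  to⊥ : FlowContinuousMod q G H f → ∀ v → ⊥Kernel q (incidenceOf H) (pushforward f (incidenceOf G v))
  to⊥ cont v ψ ψ∈ker = subst (q ∣_) (·-pushforward f (incidenceOf G v) ψ) (cont ψ ψ∈ker v)
  from⊥ : (∀ v → ⊥Kernel q (incidenceOf H) (pushforward f (incidenceOf G v))) → FlowContinuousMod q G H f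
  from⊥ c⊥ ψ ψ∈ker v = subst (q ∣_) (sym (·-pushforward f (incidenceOf G v) ψ)) (c⊥ v ψ ψ∈ker)

flowContinuousMod? : ∀ q G H → Decidable (FlowContinuousMod q G H)
flowContinuousMod? q G H f = Dec.map (⇔-sym (FlowContinuousMod⇔obstructions G H f))
  (Fin.all? (λ v → All.all? (q ∣?_) (obstructions G H f v)))

FlowContinuousMod-resp : ∀ {q} G H {f g} → f ≗ g → FlowContinuousMod q G H f → FlowContinuousMod q G H g
FlowContinuousMod-resp G H f≗g cont ψ ψ∈ker = InKernel-cong (incidenceOf G) (cong ψ ∘ f≗g) (cont ψ ψ∈ker)

IsLeastCommonMultiple : {I : Set} → ℤ → (I → ℤ) → Set
IsLeastCommonMultiple q qs = ∀ x → q ∣ x ⇔ (∀ i → qs i ∣ x)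

FlowContinuousMod-lcm : ∀ {I : Set} {q} {qs : I → ℤ} G H f → IsLeastCommonMultiple q qs →
                        FlowContinuousMod q G H f ⇔ (∀ i → FlowContinuousMod (qs i) G H f)
FlowContinuousMod-lcm {q = q} {qs} G H f lcm = mk⇔
  (λ cont i → from (obs (qs i)) (λ v → All.map (λ q∣x → to (lcm _) q∣x i) (to (obs q) cont v)))
  (λ conts → from (obs q) (λ v → All.tabulate (λ x∈ →
     from (lcm _) (λ i → All.lookup (to (obs (qs i)) (conts i) v) x∈))))
  where
  obs : ∀ q′ → FlowContinuousMod q′ G H f ⇔ (∀ v → All (q′ ∣_) (obstructions G H f v))
  obs _ = FlowContinuousMod⇔obstructions G H f

Summand : FGAb → Set
Summand M = Fin (α M) ⊎ Fin (k M)

modulus : (M : FGAb) → Summand M → ℤ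
modulus M (inj₁ _) = 0ℤ
modulus M (inj₂ i) = + n M i

data Coordinate (M : FGAb) : Set where
  free    : Fin (α M) → Coordinate M
  torsion : (i : Fin (k M)) → Fin (β M i) → Coordinate M

summandOf : ∀ {M} → Coordinate M → Summand M
summandOf (free j)      = inj₁ j
summandOf (torsion i _) = inj₂ i

coordinateModulus : ∀ {M} → Coordinate M → ℤ
coordinateModulus {M} c = modulus M (summandOf c)

coordinate : ∀ {M} → Coordinate M → Elt M → ℤ
coordinate (free j)      x = proj₁ x j
coordinate (torsion i j) x = proj₂ x i j

coordinate-0M : ∀ M (c : Coordinate M) → coordinate c (0M M) ≡ 0ℤ
coordinate-0M M (free _)      = refl
coordinate-0M M (torsion _ _) = refl

coordinate-addM : ∀ M (c : Coordinate M) x y → coordinate c (addM M x y) ≡ coordinate c x + coordinate c y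
coordinate-addM M (free _)      x y = refl
coordinate-addM M (torsion _ _) x y = refl

coordinate-sumM : ∀ M {m} (c : Coordinate M) (f : Fin m → Elt M) → coordinate c (sumM M f) ≡ sum (coordinate c ∘ f)
coordinate-sumM M {zero}  c f = coordinate-0M M c
coordinate-sumM M {suc m} c f =
  trans (coordinate-addM M c (f zero) _) (cong (_+_ (coordinate c (f zero))) (coordinate-sumM M c (f ∘ suc)))

coordinate-select : ∀ M (c : Coordinate M) {A : Set} (d : Dec A) x →
                    coordinate c (if does d then x else 0M M) ≡ ⟦ d ⟧ * coordinate c x
coordinate-select M c (yes _) x = sym (*-identityˡ (coordinate c x))
coordinate-select M c (no _)  x = coordinate-0M M c

coordinate-divergence : ∀ M G (φ : Fin (nE G) → Elt M) (c : Coordinate M) v →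
  coordinate c (outSum M G φ v) - coordinate c (inSum M G φ v) ≡ incidenceOf G v · (coordinate c ∘ φ)
coordinate-divergence M G φ c v = begin
  coordinate c (outSum M G φ v) - coordinate c (inSum M G φ v)
    ≡⟨ cong₂ _-_ (endpointSum (tail G)) (endpointSum (head G)) ⟩
  sum (λ e → ⟦ tail G e ≟ v ⟧ * φc e) - sum (λ e → ⟦ head G e ≟ v ⟧ * φc e)
    ≡⟨ sym (sum-distrib-− (λ e → ⟦ tail G e ≟ v ⟧ * φc e) (λ e → ⟦ head G e ≟ v ⟧ * φc e)) ⟩
  sum (λ e → ⟦ tail G e ≟ v ⟧ * φc e - ⟦ head G e ≟ v ⟧ * φc e)
    ≡⟨ sum-cong-≗ (λ e → factor ⟦ tail G e ≟ v ⟧ ⟦ head G e ≟ v ⟧ (φc e)) ⟩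
  incidenceOf G v · φc
    ∎
  where
  open ≡-Reasoning
  φc : Vector ℤ (nE G)
  φc = coordinate c ∘ φ
  endpointSum : ∀ (end : Fin (nE G) → Fin (nV G)) →
    coordinate c (sumM M (λ e → if does (end e ≟ v) then φ e else 0M M)) ≡ sum (λ e → ⟦ end e ≟ v ⟧ * φc e)
  endpointSum end = trans (coordinate-sumM M c (λ e → if does (end e ≟ v) then φ e else 0M M))
                          (sum-cong-≗ (λ e → coordinate-select M c (end e ≟ v) (φ e)))
  factor : ∀ a b x → a * x - b * x ≡ (a - b) * x
  factor = solve-∀

EqM⇔ : ∀ M x y → EqM M x y ⇔ (∀ (c : Coordinate M) → coordinateModulus c ∣ coordinate c x - coordinate c y)
EqM⇔ M x y = mk⇔ to′ from′
  where
  to′ : EqM M x y → ∀ (c : Coordinate M) → coordinateModulus c ∣ coordinate c x - coordinate c y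
  to′ (free≡ , _)       (free j)      = subst (0ℤ ∣_) (sym (i≡j⇒i-j≡0 (free≡ j))) ∣0
  to′ (_ , torsion∣) (torsion i j) = ∣ᵤ⇒∣ (torsion∣ i j)
  from′ : (∀ (c : Coordinate M) → coordinateModulus c ∣ coordinate c x - coordinate c y) → EqM M x y
  from′ coords∣ = (λ j → i-j≡0⇒i≡j _ _ (0∣⇒≡0 (coords∣ (free j))))
                , (λ i j → ∣⇒∣ᵤ (coords∣ (torsion i j)))

IsFlow⇔ : ∀ M G φ →
          IsFlow M G φ ⇔ (∀ (c : Coordinate M) → InKernel (coordinateModulus c) (incidenceOf G) (coordinate c ∘ φ))
IsFlow⇔ M G φ = mk⇔
  (λ flow c v → subst (coordinateModulus c ∣_) (coordinate-divergence M G φ c v) (to (balanced⇔ v) (flow v) c))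
  (λ coordsFlow v → from (balanced⇔ v) (λ c →
     subst (coordinateModulus c ∣_) (sym (coordinate-divergence M G φ c v)) (coordsFlow c v)))
  where
  balanced⇔ : ∀ v → EqM M (outSum M G φ v) (inSum M G φ v) ⇔
                     (∀ c → coordinateModulus c ∣ coordinate c (outSum M G φ v) - coordinate c (inSum M G φ v))
  balanced⇔ v = EqM⇔ M (outSum M G φ v) (inSum M G φ v)

embed : ∀ M → Summand M → ℤ → Elt M
embed M (inj₁ _) x = (λ _ → x) , (λ _ _ → 0ℤ)
embed M (inj₂ i) x = (λ _ → 0ℤ) , (λ i′ _ → if does (i′ ≟ i) then x else 0ℤ)

embed-isFlow : ∀ M G s ψ → InKernel (modulus M s) (incidenceOf G) ψ → IsFlow M G (embed M s ∘ ψ)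
embed-isFlow M G (inj₁ j) ψ ψ∈ker = from (IsFlow⇔ M G _) λ
  { (free _)      → ψ∈ker
  ; (torsion _ _) → InKernel-zero (incidenceOf G) }
embed-isFlow M G (inj₂ i) ψ ψ∈ker = from (IsFlow⇔ M G _) λ
  { (free _)       → InKernel-zero (incidenceOf G)
  ; (torsion i′ _) → selected (i′ ≟ i) }
  where
  selected : ∀ {i′} (d : Dec (i′ ≡ i)) → InKernel (+ n M i′) (incidenceOf G) (λ e → if does d then ψ e else 0ℤ)
  selected (yes refl) = ψ∈ker
  selected (no _)     = InKernel-zero (incidenceOf G)

FlowContinuous⇒coordinate : ∀ M G H f → FlowContinuous M G H f → (c : Coordinate M) →
                            (∀ x → coordinate c (embed M (summandOf c) x) ≡ x) →
                            FlowContinuousMod (coordinateModulus c) G H f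
FlowContinuous⇒coordinate M G H f cont c embed-section ψ ψ∈ker =
  InKernel-cong (incidenceOf G) (embed-section ∘ ψ ∘ f)
    (to (IsFlow⇔ M G (φ ∘ f)) (cont φ (embed-isFlow M H (summandOf c) ψ ψ∈ker)) c)
  where
  φ : Fin (nE H) → Elt M
  φ = embed M (summandOf c) ∘ ψ

FlowContinuous⇒summand : ∀ M G H f → FlowContinuous M G H f → ∀ s → FlowContinuousMod (modulus M s) G H f
FlowContinuous⇒summand M G H f cont (inj₁ j) = FlowContinuous⇒coordinate M G H f cont (free j) (λ _ → refl)
FlowContinuous⇒summand M G H f cont (inj₂ i) =
  FlowContinuous⇒coordinate M G H f cont (torsion i (fromℕ< (β-pos M i)))
    (λ x → cong (λ b → if b then x else 0ℤ) (dec-true (i ≟ i) refl))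

FlowContinuous⇔ : ∀ M G H f → FlowContinuous M G H f ⇔ (∀ s → FlowContinuousMod (modulus M s) G H f)
FlowContinuous⇔ M G H f = mk⇔ (FlowContinuous⇒summand M G H f)
  (λ conts φ φ-flow → from (IsFlow⇔ M G (φ ∘ f)) (λ c →
     conts (summandOf c) (coordinate c ∘ φ) (to (IsFlow⇔ M H φ) φ-flow c)))

lcmFin-∣ : ∀ {k} (ns : Fin k → ℕ) i → ns i ℕ.∣ lcmFin ns
lcmFin-∣ ns zero    = m∣lcm[m,n] (ns zero) _
lcmFin-∣ ns (suc i) = ℕ.∣-trans (lcmFin-∣ (ns ∘ suc) i) (n∣lcm[m,n] (ns zero) _)

lcmFin-least : ∀ {k} (ns : Fin k → ℕ) {y} → (∀ i → ns i ℕ.∣ y) → lcmFin ns ℕ.∣ y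
lcmFin-least {zero}  ns {y} _  = ℕ.1∣ y
lcmFin-least {suc k} ns     ns∣y = lcm-least (ns∣y zero) (lcmFin-least (ns ∘ suc) (ns∣y ∘ suc))

lcmFin-isLcm : ∀ {k} (ns : Fin k → ℕ) → IsLeastCommonMultiple (+ lcmFin ns) (λ i → + ns i)
lcmFin-isLcm ns x = mk⇔ (λ lcm∣x i → ∣-trans (∣ᵤ⇒∣ (lcmFin-∣ ns i)) lcm∣x)
                        (λ ns∣x → ∣ᵤ⇒∣ (lcmFin-least ns (λ i → ∣⇒∣ᵤ (ns∣x i))))

-- ∞ becomes 0, the modulus of ℤ: 0 ∣ x means x = 0.
toModulus : ℕ∞ → ℤ
toModulus (fin e) = + e
toModulus ∞       = 0ℤ

nOf-isLcm : ∀ M → IsLeastCommonMultiple (toModulus (nOf M)) (modulus M)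
nOf-isLcm record { α = zero ; n = ns } x = mk⇔
  (λ { lcm∣x (inj₁ ()) ; lcm∣x (inj₂ i) → to (lcmFin-isLcm ns x) lcm∣x i })
  (λ ns∣x → from (lcmFin-isLcm ns x) (ns∣x ∘ inj₂))
nOf-isLcm record { α = suc _ } x = mk⇔
  (λ 0∣x s → subst (modulus _ s ∣_) (sym (0∣⇒≡0 0∣x)) ∣0)
  (λ all∣x → all∣x (inj₁ zero))

FlowContinuous⇔FlowContinuousMod-nOf : ∀ M G H f →
                                       FlowContinuous M G H f ⇔ FlowContinuousMod (toModulus (nOf M)) G H f
FlowContinuous⇔FlowContinuousMod-nOf M G H f =
  ⇔-trans (FlowContinuous⇔ M G H f) (⇔-sym (FlowContinuousMod-lcm G H f (nOf-isLcm M)))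

Enumerates : ∀ {N c} → (Fin N → Set) → (Fin c → Fin N) → Set
Enumerates {c = c} Q enum =
  (∀ i j → enum i ≡ enum j → i ≡ j) × (∀ i → Q (enum i)) × (∀ x → Q x → Σ (Fin c) λ i → x ≡ enum i)

enumerate : ∀ {N} {Q : Fin N → Set} → Decidable Q → Σ ℕ λ c → Σ (Fin c → Fin N) (Enumerates Q)
enumerate {zero} Q? = 0 , (λ ()) , (λ ()) , (λ ()) , (λ ())
enumerate {suc N} {Q} Q? with enumerate (Q? ∘ suc) | Q? zero
... | c , enum , inj , sat , cov | yes Q₀ = suc c , enum′ , inj′ , sat′ , cov′
  where
  enum′ : Fin (suc c) → Fin (suc N)
  enum′ zero    = zero
  enum′ (suc i) = suc (enum i)
  inj′ : ∀ i j → enum′ i ≡ enum′ j → i ≡ j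
  inj′ zero    zero    _  = refl
  inj′ (suc i) (suc j) eq = cong suc (inj i j (Fin.suc-injective eq))
  sat′ : ∀ i → Q (enum′ i)
  sat′ zero    = Q₀
  sat′ (suc i) = sat i
  cov′ : ∀ x → Q x → Σ (Fin (suc c)) λ i → x ≡ enum′ i
  cov′ zero    _  = zero , refl
  cov′ (suc x) Qx = let i , x≡ = cov x Qx in suc i , cong suc x≡
... | c , enum , inj , sat , cov | no ¬Q₀ = c , suc ∘ enum , (λ i j → inj i j ∘ Fin.suc-injective) , sat , cov′
  where
  cov′ : ∀ x → Q x → Σ (Fin c) λ i → x ≡ suc (enum i)
  cov′ zero    Q₀ = ⊥-elim (¬Q₀ Q₀)
  cov′ (suc x) Qx = let i , x≡ = cov x Qx in i , cong suc x≡

funToFin-cong : ∀ {m n} {f g : Fin m → Fin n} → f ≗ g → funToFin f ≡ funToFin g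
funToFin-cong {zero}  _   = refl
funToFin-cong {suc m} f≗g = cong₂ combine (f≗g zero) (funToFin-cong (f≗g ∘ suc))

hasCount : ∀ {a b} (P : (Fin a → Fin b) → Set) → Decidable P → (∀ {f g} → f ≗ g → P f → P g) →
           Σ ℕ (HasCount P)
hasCount {a} {b} P P? resp with enumerate (P? ∘ finToFun)
... | c , enum , inj , sat , cov = c , finToFun ∘ enum , inj′ , sat , cov′
  where
  decode : Fin (b ℕ.^ a) → Fin a → Fin b
  decode = finToFun
  inj′ : ∀ i j → decode (enum i) ≗ decode (enum j) → i ≡ j
  inj′ i j eq = inj i j (begin
    enum i                     ≡⟨ sym (funToFin-finToFin {a} {b} (enum i)) ⟩
    funToFin (decode (enum i)) ≡⟨ funToFin-cong eq ⟩
    funToFin (decode (enum j)) ≡⟨ funToFin-finToFin {a} {b} (enum j) ⟩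
    enum j                     ∎)
    where open ≡-Reasoning
  cov′ : ∀ f → P f → Σ (Fin c) λ i → f ≗ decode (enum i)
  cov′ f Pf = let i , f≡ = cov (funToFin f) (resp (sym ∘ finToFun-funToFin f) Pf)
              in i , λ x → trans (sym (finToFun-funToFin f x)) (cong (λ y → decode y x) f≡)

HasCount-⇔ : ∀ {a b c} {P Q : (Fin a → Fin b) → Set} → (∀ f → P f ⇔ Q f) → HasCount P c → HasCount Q c
HasCount-⇔ P⇔Q (enum , inj , sat , cov) =
  enum , inj , (λ i → to (P⇔Q (enum i)) (sat i)) , (λ f → cov f ∘ from (P⇔Q f))

theorem2p4 : (G H : Digraph) (M N : FGAb) → nOf M ≡ nOf N →
    Σ ℕ λ c → HasCount (FlowContinuous M G H) c × HasCount (FlowContinuous N G H) c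
theorem2p4 G H M N nM≡nN = c , countFor M count , countFor N (subst (λ e → HasCount (ContinuousMod e) c) nM≡nN count)
  where
  ContinuousMod : ℕ∞ → (Fin (nE G) → Fin (nE H)) → Set
  ContinuousMod e = FlowContinuousMod (toModulus e) G H
  counted : Σ ℕ (HasCount (ContinuousMod (nOf M)))
  counted = hasCount _ (flowContinuousMod? _ G H) (FlowContinuousMod-resp G H)
  c : ℕ
  c = proj₁ counted
  count : HasCount (ContinuousMod (nOf M)) c
  count = proj₂ counted
  countFor : ∀ K {c} → HasCount (ContinuousMod (nOf K)) c → HasCount (FlowContinuous K G H) c
  countFor K = HasCount-⇔ (λ f → ⇔-sym (FlowContinuous⇔FlowContinuousMod-nOf K G H f))
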